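{- Let $(F,(a,b))$ be an edge-rooted graph. If $F$ is rigid and every two vertices of $F$ have a copy of $K_3$ in their common neighbourhood, then $\mathrm{Hom}(F^{\mathrm{sym}},F^{\mathrm{sym}})=\{\mathrm{id},\sigma\}$, where $\sigma$ is an automorphism of $F^{\mathrm{sym}}$ with $\sigma(a)=b$ and $\sigma(b)=a$.
   Context: An edge-rooted graph is a pair $(F,(a,b))$ with $F$ a graph and $(a,b)$ an orientation of an edge of $F$. $F$ is rigid if its only endomorphism is the identity. The symmetrization $F^{\mathrm{sym}}$ is the graph obtained from two disjoint copies $F_1,F_2$ of $F$, with roots $(a_1,b_1)$ in $F_1$ and $(a_2,b_2)$ in $F_2$, by identifying $a_1$ with $b_2$ (call the result $a$) and $b_1$ with $a_2$ (call the result $b$); it is rooted at $(a,b)$. $\mathrm{Hom}(G,H)$ denotes the set of graph homomorphisms (adjacency-preserving vertex maps) from $G$ to $H$. -}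

module Defs where

open import Data.Nat using (ℕ)
open import Data.Fin using (Fin; _≟_)
open import Data.Sum using (_⊎_; inj₁; inj₂)
open import Data.Product using (Σ; ∃; _×_; _,_)
open import Relation.Nullary using (¬_; yes; no)
open import Relation.Nullary.Decidable using (False; fromWitnessFalse)
open import Relation.Binary.PropositionalEquality using (_≡_)

record SimpleGraph (n : ℕ) : Set₁ where
  field
    E      : Fin n → Fin n → Set
    sym    : ∀ {x y} → E x y → E y x
    irrefl : ∀ {x} → ¬ E x x
open SimpleGraph public

IsHom : {V W : Set} → (V → V → Set) → (W → W → Set) → (V → W) → Set
IsHom {V} EV EW f = ∀ {x y : V} → EV x y → EW (f x) (f y)

Rigid : {n : ℕ} → SimpleGraph n → Set
Rigid {n} F = (f : Fin n → Fin n) → IsHom (E F) (E F) f → ∀ x → f x ≡ x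

CommonK3 : {n : ℕ} → SimpleGraph n → Set
CommonK3 {n} F = ∀ (u v : Fin n) → Σ (Fin n) λ x → Σ (Fin n) λ y → Σ (Fin n) λ z →
  (E F x y × E F y z × E F x z) ×
  (E F u x × E F u y × E F u z) ×
  (E F v x × E F v y × E F v z)

-- Vertex set of the symmetrization: all of the first copy F₁, plus the
-- vertices of the second copy F₂ other than a₂, b₂ (which are glued to b₁, a₁).
SymV : (n : ℕ) → Fin n → Fin n → Set
SymV n a b = Fin n ⊎ Σ (Fin n) (λ v → False (v ≟ a) × False (v ≟ b))

ι₁ : {n : ℕ} {a b : Fin n} → Fin n → SymV n a b
ι₁ v = inj₁ v

ι₂ : {n : ℕ} {a b : Fin n} → Fin n → SymV n a b
ι₂ {n} {a} {b} v with v ≟ a | v ≟ b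
... | yes _ | _     = inj₁ b
... | no _  | yes _ = inj₁ a
... | no p  | no q  = inj₂ (v , fromWitnessFalse p , fromWitnessFalse q)

SymE : {n : ℕ} (F : SimpleGraph n) (a b : Fin n) → SymV n a b → SymV n a b → Set
SymE {n} F a b x y =
  (Σ (Fin n) λ u → Σ (Fin n) λ v → E F u v × ι₁ {n} {a} {b} u ≡ x × ι₁ {n} {a} {b} v ≡ y)
  ⊎ (Σ (Fin n) λ u → Σ (Fin n) λ v → E F u v × ι₂ {n} {a} {b} u ≡ x × ι₂ {n} {a} {b} v ≡ y)

symA : {n : ℕ} {a b : Fin n} → SymV n a b
symA {a = a} = inj₁ a

symB : {n : ℕ} {a b : Fin n} → SymV n a b
symB {b = b} = inj₁ b

IsAut : {V : Set} → (V → V → Set) → (V → V) → Set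
IsAut {V} EV σ = IsHom EV EV σ × Σ (V → V) λ τ →
  IsHom EV EV τ × (∀ x → τ (σ x) ≡ x) × (∀ x → σ (τ x) ≡ x)

-- In F^sym only a and b are shared by the two copies, so every triangle has a
-- vertex private to one copy, and no edge joins the private parts of the two
-- copies. Given x, y in a copy, the common-K3 condition gives a triangle
-- adjacent to both; its private vertex, mapped under a homomorphism h, is
-- adjacent to h x and h y, so h cannot send one of them into the private part
-- of copy 1 and the other into that of copy 2. Hence h maps each copy of F
-- into a single copy, where by rigidity it is the canonical embedding. The two
-- copies cannot land in the same copy, since a₁ = b₂ would force a = b; so h is
-- the identity or the swap of the copies.
module Submission where

open import Defs hiding (sym)
open import Data.Bool.Properties using (T-irrelevant)
open import Data.Nat using (ℕ)
open import Data.Fin using (Fin; _≟_)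
open import Data.Fin.Properties using (any?)
open import Data.Sum using (_⊎_; inj₁; inj₂)
open import Data.Sum.Properties using (inj₁-injective)
open import Data.Product using (Σ; ∃; _×_; _,_; proj₁; proj₂)
open import Data.Empty using (⊥; ⊥-elim)
open import Function using (_∘_)
open import Function.Definitions using (Injective)
open import Relation.Nullary using (¬_; yes; no)
open import Relation.Nullary.Decidable using (False; toWitnessFalse)
open import Relation.Unary using (Decidable)
open import Relation.Binary.PropositionalEquality
  using (_≡_; refl; sym; trans; cong; cong₂; subst; subst₂; module ≡-Reasoning)

module Symmetrization {n : ℕ} (F : SimpleGraph n) (a b : Fin n) (ab : E F a b) where

  V : Set
  V = SymV n a b

  _~_ : V → V → Set
  _~_ = SymE F a b

  copy₂ : Fin n → V
  copy₂ = ι₂ {n} {a} {b}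

  a≢b : ¬ a ≡ b
  a≢b refl = irrefl F ab

  copy₂-a : copy₂ a ≡ inj₁ b
  copy₂-a with a ≟ a
  ... | yes _   = refl
  ... | no a≢a = ⊥-elim (a≢a refl)

  copy₂-b : copy₂ b ≡ inj₁ a
  copy₂-b with b ≟ a | b ≟ b
  ... | yes b≡a | _      = ⊥-elim (a≢b (sym b≡a))
  ... | no _    | yes _  = refl
  ... | no _    | no b≢b = ⊥-elim (b≢b refl)

  copy₂-off-shared : ∀ v → ¬ v ≡ a → ¬ v ≡ b → ∃ λ t → copy₂ v ≡ inj₂ t × proj₁ t ≡ v
  copy₂-off-shared v v≢a v≢b with v ≟ a | v ≟ b
  ... | yes v≡a | _       = ⊥-elim (v≢a v≡a)
  ... | no _    | yes v≡b = ⊥-elim (v≢b v≡b)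
  ... | no _    | no _    = _ , refl , refl

  copy₂-private : ∀ v (p : False (v ≟ a)) (q : False (v ≟ b)) → copy₂ v ≡ inj₂ (v , p , q)
  copy₂-private v p q with copy₂-off-shared v (toWitnessFalse p) (toWitnessFalse q)
  ... | (.v , p′ , q′) , eq , refl =
    trans eq (cong₂ (λ p q → inj₂ (v , p , q)) (T-irrelevant p′ p) (T-irrelevant q′ q))

  copy₂≡inj₁ : ∀ {u w} → copy₂ u ≡ inj₁ w → (u ≡ a × w ≡ b) ⊎ (u ≡ b × w ≡ a)
  copy₂≡inj₁ {u} eq with u ≟ a | u ≟ b
  copy₂≡inj₁ refl | yes u≡a | _       = inj₁ (u≡a , refl)
  copy₂≡inj₁ refl | no _    | yes u≡b = inj₂ (u≡b , refl)
  copy₂≡inj₁ ()   | no _    | no _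

  copies-cover : ∀ z → (∃ λ v → z ≡ inj₁ v) ⊎ (∃ λ v → z ≡ copy₂ v)
  copies-cover (inj₁ v)           = inj₁ (v , refl)
  copies-cover (inj₂ (v , p , q)) = inj₂ (v , sym (copy₂-private v p q))

  copy₁-edge : ∀ {u v} → E F u v → inj₁ u ~ inj₁ v
  copy₁-edge {u} {v} e = inj₁ (u , v , e , refl , refl)

  -- An edge of the second copy between shared vertices is a₂b₂, i.e. ab reversed.
  inj₁~inj₁⇒E : ∀ {u v} → inj₁ u ~ inj₁ v → E F u v
  inj₁~inj₁⇒E (inj₁ (_ , _ , e , refl , refl)) = e
  inj₁~inj₁⇒E (inj₂ (u′ , v′ , e , eu , ev)) with copy₂≡inj₁ eu | copy₂≡inj₁ ev
  ... | inj₁ (refl , _)    | inj₁ (refl , _)    = ⊥-elim (irrefl F e)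
  ... | inj₁ (refl , refl) | inj₂ (refl , refl) = SimpleGraph.sym F e
  ... | inj₂ (refl , refl) | inj₁ (refl , refl) = SimpleGraph.sym F e
  ... | inj₂ (refl , _)    | inj₂ (refl , _)    = ⊥-elim (irrefl F e)

  swap : V → V
  swap (inj₁ v)           = copy₂ v
  swap (inj₂ (v , _ , _)) = inj₁ v

  swap-copy₂ : ∀ v → swap (copy₂ v) ≡ inj₁ v
  swap-copy₂ v with v ≟ a | v ≟ b
  ... | yes refl | _        = copy₂-b
  ... | no _     | yes refl = copy₂-a
  ... | no _     | no _     = refl

  swap-involutive : ∀ z → swap (swap z) ≡ z
  swap-involutive (inj₁ v)           = swap-copy₂ v
  swap-involutive (inj₂ (v , p , q)) = copy₂-private v p q

  swap-hom : IsHom _~_ _~_ swap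
  swap-hom (inj₁ (u , v , e , eu , ev)) = inj₂ (u , v , e , cong swap eu , cong swap ev)
  swap-hom (inj₂ (u , v , e , eu , ev)) =
    inj₁ (u , v , e , trans (sym (swap-copy₂ u)) (cong swap eu)
                    , trans (sym (swap-copy₂ v)) (cong swap ev))

  copy₂-injective : Injective _≡_ _≡_ copy₂
  copy₂-injective {u} {v} eq =
    inj₁-injective (trans (sym (swap-copy₂ u)) (trans (cong swap eq) (swap-copy₂ v)))

  ~-sym : ∀ {x y} → x ~ y → y ~ x
  ~-sym (inj₁ (u , v , e , eu , ev)) = inj₁ (v , u , SimpleGraph.sym F e , ev , eu)
  ~-sym (inj₂ (u , v , e , eu , ev)) = inj₂ (v , u , SimpleGraph.sym F e , ev , eu)

  ~-irrefl : ∀ {x} → ¬ x ~ x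
  ~-irrefl (inj₁ (u , v , e , eu , ev)) =
    irrefl F (subst (E F u) (inj₁-injective (trans ev (sym eu))) e)
  ~-irrefl (inj₂ (u , v , e , eu , ev)) =
    irrefl F (subst (E F u) (copy₂-injective (trans ev (sym eu))) e)

  Private₁ : V → Set
  Private₁ z = ∃ λ v → z ≡ inj₁ v × ¬ v ≡ a × ¬ v ≡ b

  Private₂ : V → Set
  Private₂ z = ∃ λ t → z ≡ inj₂ t

  Private : V → Set
  Private z = Private₁ z ⊎ Private₂ z

  Shared : V → Set
  Shared z = z ≡ inj₁ a ⊎ z ≡ inj₁ b

  private-or-shared : ∀ z → Private z ⊎ Shared z
  private-or-shared (inj₂ t) = inj₁ (inj₂ (t , refl))
  private-or-shared (inj₁ v) with v ≟ a | v ≟ b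
  ... | yes refl | _       = inj₂ (inj₁ refl)
  ... | no _     | yes refl = inj₂ (inj₂ refl)
  ... | no v≢a   | no v≢b  = inj₁ (inj₁ (v , refl , v≢a , v≢b))

  private₁? : Decidable Private₁
  private₁? (inj₂ t) = no λ { (_ , () , _) }
  private₁? (inj₁ v) with v ≟ a | v ≟ b
  ... | yes v≡a | _       = no λ { (_ , refl , v≢a , _) → v≢a v≡a }
  ... | no _    | yes v≡b = no λ { (_ , refl , _ , v≢b) → v≢b v≡b }
  ... | no v≢a  | no v≢b  = yes (v , refl , v≢a , v≢b)

  private₁≁private₂ : ∀ {x y} → x ~ y → Private₁ x → Private₂ y → ⊥
  private₁≁private₂ (inj₁ (_ , _ , _ , _ , refl)) _ (_ , ())
  private₁≁private₂ (inj₂ (_ , _ , _ , eu , _)) (_ , refl , v≢a , v≢b) _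
    with copy₂≡inj₁ eu
  ... | inj₁ (_ , v≡b) = v≢b v≡b
  ... | inj₂ (_ , v≡a) = v≢a v≡a

  shared-pigeonhole : ∀ {x y z} → Shared x → Shared y → Shared z → x ≡ y ⊎ y ≡ z ⊎ x ≡ z
  shared-pigeonhole (inj₁ refl) (inj₁ refl) _           = inj₁ refl
  shared-pigeonhole (inj₂ refl) (inj₂ refl) _           = inj₁ refl
  shared-pigeonhole (inj₁ refl) (inj₂ refl) (inj₁ refl) = inj₂ (inj₂ refl)
  shared-pigeonhole (inj₁ refl) (inj₂ refl) (inj₂ refl) = inj₂ (inj₁ refl)
  shared-pigeonhole (inj₂ refl) (inj₁ refl) (inj₁ refl) = inj₂ (inj₁ refl)
  shared-pigeonhole (inj₂ refl) (inj₁ refl) (inj₂ refl) = inj₂ (inj₂ refl)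

  triangle-has-private : ∀ {x y z} → x ~ y → y ~ z → x ~ z → Private x ⊎ Private y ⊎ Private z
  triangle-has-private {x} {y} {z} xy yz xz
    with private-or-shared x | private-or-shared y | private-or-shared z
  ... | inj₁ px | _      | _       = inj₁ px
  ... | inj₂ _  | inj₁ py | _       = inj₂ (inj₁ py)
  ... | inj₂ _  | inj₂ _  | inj₁ pz = inj₂ (inj₂ pz)
  ... | inj₂ sx | inj₂ sy | inj₂ sz with shared-pigeonhole sx sy sz
  ... | inj₁ refl        = ⊥-elim (~-irrefl xy)
  ... | inj₂ (inj₁ refl) = ⊥-elim (~-irrefl yz)
  ... | inj₂ (inj₂ refl) = ⊥-elim (~-irrefl xz)

  LandsInCopy₁ : (Fin n → V) → Set
  LandsInCopy₁ g = ∀ x → ∃ λ w → g x ≡ inj₁ w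

  module _ {h : V → V} (h-hom : IsHom _~_ _~_ h) where

    ¬private₁-and-private₂ : CommonK3 F → ∀ x y → Private₁ (h (inj₁ x)) → Private₂ (h (inj₁ y)) → ⊥
    ¬private₁-and-private₂ K x y px py with K x y
    ... | t₁ , t₂ , t₃ , (e₁₂ , e₂₃ , e₁₃) , (x₁ , x₂ , x₃) , (y₁ , y₂ , y₃)
      with triangle-has-private (h-hom (copy₁-edge e₁₂)) (h-hom (copy₁-edge e₂₃))
                                (h-hom (copy₁-edge e₁₃))
    ... | inj₁ (inj₁ p)        = private₁≁private₂ (~-sym (h-hom (copy₁-edge y₁))) p py
    ... | inj₁ (inj₂ p)        = private₁≁private₂ (h-hom (copy₁-edge x₁)) px p
    ... | inj₂ (inj₁ (inj₁ p)) = private₁≁private₂ (~-sym (h-hom (copy₁-edge y₂))) p py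
    ... | inj₂ (inj₁ (inj₂ p)) = private₁≁private₂ (h-hom (copy₁-edge x₂)) px p
    ... | inj₂ (inj₂ (inj₁ p)) = private₁≁private₂ (~-sym (h-hom (copy₁-edge y₃))) p py
    ... | inj₂ (inj₂ (inj₂ p)) = private₁≁private₂ (h-hom (copy₁-edge x₃)) px p

    copy₁-lands-in-one-copy : CommonK3 F → LandsInCopy₁ (h ∘ inj₁) ⊎ LandsInCopy₁ (swap ∘ h ∘ inj₁)
    copy₁-lands-in-one-copy K with any? (private₁? ∘ h ∘ inj₁)
    ... | yes (x , px) = inj₁ λ y → ¬private₂⇒inj₁ (h (inj₁ y)) (¬private₁-and-private₂ K x y px)
      where
        ¬private₂⇒inj₁ : ∀ z → ¬ Private₂ z → ∃ λ w → z ≡ inj₁ w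
        ¬private₂⇒inj₁ (inj₁ w) _  = w , refl
        ¬private₂⇒inj₁ (inj₂ t) ¬p = ⊥-elim (¬p (t , refl))
    ... | no ¬p = inj₂ λ y → ¬private₁⇒swap-inj₁ (h (inj₁ y)) (λ p → ¬p (y , p))
      where
        ¬private₁⇒swap-inj₁ : ∀ z → ¬ Private₁ z → ∃ λ w → swap z ≡ inj₁ w
        ¬private₁⇒swap-inj₁ z ¬p with private-or-shared z
        ... | inj₁ (inj₁ p)                = ⊥-elim (¬p p)
        ... | inj₁ (inj₂ ((v , _) , refl)) = v , refl
        ... | inj₂ (inj₁ refl)             = b , copy₂-a
        ... | inj₂ (inj₂ refl)             = a , copy₂-b

    rigid-fixes-copy₁ : Rigid F → LandsInCopy₁ (h ∘ inj₁) → ∀ x → h (inj₁ x) ≡ inj₁ x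
    rigid-fixes-copy₁ R lands x = trans (proj₂ (lands x)) (cong inj₁ (R g g-hom x))
      where
        g : Fin n → Fin n
        g = proj₁ ∘ lands
        g-hom : IsHom (E F) (E F) g
        g-hom {u} {v} e =
          inj₁~inj₁⇒E (subst₂ _~_ (proj₂ (lands u)) (proj₂ (lands v)) (h-hom (copy₁-edge e)))

  hom-on-copy₁ : Rigid F → CommonK3 F → ∀ {h} → IsHom _~_ _~_ h →
    (∀ x → h (inj₁ x) ≡ inj₁ x) ⊎ (∀ x → h (inj₁ x) ≡ copy₂ x)
  hom-on-copy₁ R K {h} h-hom with copy₁-lands-in-one-copy h-hom K
  ... | inj₁ lands = inj₁ (rigid-fixes-copy₁ h-hom R lands)
  ... | inj₂ lands = inj₂ λ x →
    trans (sym (swap-involutive (h (inj₁ x))))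
          (cong swap (rigid-fixes-copy₁ (swap-hom ∘ h-hom) R lands x))

  copies-not-merged : ∀ {h} (c : Fin n → V) → Injective _≡_ _≡_ c →
    (∀ x → h (inj₁ x) ≡ c x) → (∀ x → h (copy₂ x) ≡ c x) → ⊥
  copies-not-merged {h} c c-injective on₁ on₂ = a≢b (c-injective (begin
    c a            ≡⟨ sym (on₁ a) ⟩
    h (inj₁ a)     ≡⟨ cong h (sym copy₂-b) ⟩
    h (copy₂ b)    ≡⟨ on₂ b ⟩
    c b            ∎))
    where open ≡-Reasoning

  agree-on-copies : ∀ {f g : V → V} → (∀ x → f (inj₁ x) ≡ g (inj₁ x)) →
    (∀ x → f (copy₂ x) ≡ g (copy₂ x)) → ∀ z → f z ≡ g z
  agree-on-copies on₁ on₂ z with copies-cover z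
  ... | inj₁ (v , refl) = on₁ v
  ... | inj₂ (v , refl) = on₂ v

  endomorphism-is-id-or-swap : Rigid F → CommonK3 F → ∀ {h} → IsHom _~_ _~_ h →
    (∀ z → h z ≡ z) ⊎ (∀ z → h z ≡ swap z)
  endomorphism-is-id-or-swap R K {h} h-hom
    with hom-on-copy₁ R K h-hom | hom-on-copy₁ R K (h-hom ∘ swap-hom)
  ... | inj₁ on₁ | inj₂ on₂ = inj₁ (agree-on-copies on₁ on₂)
  ... | inj₂ on₁ | inj₁ on₂ =
    inj₂ (agree-on-copies on₁ λ x → trans (on₂ x) (sym (swap-copy₂ x)))
  ... | inj₁ on₁ | inj₁ on₂ = ⊥-elim (copies-not-merged {h} inj₁ inj₁-injective on₁ on₂)
  ... | inj₂ on₁ | inj₂ on₂ = ⊥-elim (copies-not-merged {h} copy₂ copy₂-injective on₁ on₂)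

proposition4p1 : (n : ℕ) (F : SimpleGraph n) (a b : Fin n) → E F a b →
    Rigid F → CommonK3 F →
    Σ (SymV n a b → SymV n a b) λ σ →
    IsAut (SymE F a b) σ ×
    σ (symA {n} {a} {b}) ≡ symB {n} {a} {b} ×
    σ (symB {n} {a} {b}) ≡ symA {n} {a} {b} ×
    ((f : SymV n a b → SymV n a b) → IsHom (SymE F a b) (SymE F a b) f →
    (∀ x → f x ≡ x) ⊎ (∀ x → f x ≡ σ x))
proposition4p1 n F a b ab R K =
  swap , (swap-hom , swap , swap-hom , swap-involutive , swap-involutive) , copy₂-a , copy₂-b ,
  λ f f-hom → endomorphism-is-id-or-swap R K f-hom
  where open Symmetrization F a b ab
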